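{- If $G$ is a finite connected simple bipartite graph, then for every $u$ the Bartholdi zeta function $\zeta_G(q,u)$ is an even function of $q$.
   Context: $G$ has $n_V$ vertices, $n_E$ edges, adjacency matrix $A$, degree matrix $D=\mathrm{diag}(\deg v)$, and $Q_u=(1-u)\bigl(D-(1-u)I_{n_V}\bigr)$. The Bartholdi zeta function is defined for small $|q|,|u|$ by the Euler product $\zeta_G(q,u)=\prod_{[C]}(1-q^{|C|}u^{b(C)})^{ -1}$ over rotation-equivalence classes of primitive cycles (closed walks on directed edges), $|C|$ the length, $b(C)$ the number of bumps (consecutive traversal of an edge and its reverse, counted cyclically); it equals the rational function $(1-(1-u)^2q^2)^{ -(n_E-n_V)}\det(I_{n_V}-qA+q^2Q_u)^{ -1}$, and $\zeta_G(q,u)$ denotes this rational function. -}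

module Defs where

open import Level using (Level; _⊔_)
open import Data.Nat using (ℕ; zero; suc; _<_; _<ᵇ_)
open import Data.Integer using (ℤ; +_; -[1+_]) renaming (_-_ to _-ℤ_)
open import Data.Fin using (Fin; zero; suc; toℕ; punchIn)
open import Data.Bool using (Bool; true; false; if_then_else_; _∧_)
open import Relation.Binary.PropositionalEquality using (_≡_; _≢_)
open import Algebra.Bundles using (CommutativeRing)
open import Relation.Nullary.Decidable.Core using (does)
open import Data.Fin.Properties using (_≟_)
open import Data.Product using (Σ)

record SimpleGraph : Set where
  field
    nV     : ℕ
    adj    : Fin nV → Fin nV → Bool
    sym    : ∀ i j → adj i j ≡ adj j i
    irrefl : ∀ i → adj i i ≡ false
open SimpleGraph public

data Reachable (G : SimpleGraph) : Fin (nV G) → Fin (nV G) → Set where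
  here : ∀ {i} → Reachable G i i
  step : ∀ {i j k} → adj G i j ≡ true → Reachable G j k → Reachable G i k

record Connected (G : SimpleGraph) : Set where
  field
    nonempty  : 0 < nV G
    reachable : ∀ i j → Reachable G i j

Bipartite : SimpleGraph → Set
Bipartite G = Σ (Fin (nV G) → Bool) λ c → ∀ i j → adj G i j ≡ true → c i ≢ c j

sumℕ : ∀ {n} → (Fin n → ℕ) → ℕ
sumℕ {zero}  f = 0
sumℕ {suc n} f = Data.Nat._+_ (f zero) (sumℕ (λ i → f (suc i)))

nE : SimpleGraph → ℕ
nE G = sumℕ λ i → sumℕ λ j →
  if (toℕ i <ᵇ toℕ j) ∧ adj G i j then 1 else 0

edgeExcess : SimpleGraph → ℤ
edgeExcess G = + nE G -ℤ + nV G

module Zeta {c ℓ : Level} (R : CommutativeRing c ℓ) where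
  open CommutativeRing R using (Carrier; _≈_; _+_; _*_; -_; _-_; 0#; 1#)

  Matrix : ℕ → Set c
  Matrix n = Fin n → Fin n → Carrier

  Σ[_] : ∀ {n} → (Fin n → Carrier) → Carrier
  Σ[_] {zero}  f = 0#
  Σ[_] {suc n} f = f zero + Σ[ (λ i → f (suc i)) ]

  sign : ℕ → Carrier
  sign zero    = 1#
  sign (suc k) = - sign k

  pow : Carrier → ℕ → Carrier
  pow x zero    = 1#
  pow x (suc k) = x * pow x k

  -- minor: delete row 0 and column j
  minor : ∀ {n} → Matrix (suc n) → Fin (suc n) → Matrix n
  minor M j r s = M (suc r) (punchIn j s)

  det : ∀ {n} → Matrix n → Carrier
  det {zero}  M = 1#
  det {suc n} M = Σ[ (λ j → sign (toℕ j) * (M zero j * det (minor M j))) ]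

  module _ (G : SimpleGraph) where
    private n = nV G

    δ : Fin n → Fin n → Carrier
    δ i j = if does (i ≟ j) then 1# else 0#

    A : Matrix n
    A i j = if adj G i j then 1# else 0#

    deg : Fin n → Carrier
    deg i = Σ[ (λ j → A i j) ]

    Q : Carrier → Matrix n
    Q u i j = (1# - u) * (δ i j * deg i - (1# - u) * δ i j)

    M : Carrier → Carrier → Matrix n
    M q u i j = δ i j - q * A i j + (q * q) * Q u i j

    F : Carrier → Carrier → Carrier
    F q u = 1# - ((1# - u) * (1# - u)) * (q * q)

    -- ζ_G(q,u) = F^{-(nE-nV)} det(M)^{-1} = zetaNum / zetaDen, with the
    -- integer exponent nE - nV split by sign
    zetaNum : Carrier → Carrier → Carrier
    zetaNum q u with edgeExcess G
    ... | + k      = 1#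
    ... | -[1+ k ] = pow (F q u) (suc k)

    zetaDen : Carrier → Carrier → Carrier
    zetaDen q u with edgeExcess G
    ... | + k      = pow (F q u) k * det (M q u)
    ... | -[1+ k ] = det (M q u)

    -- z is the value ζ_G(q,u): z · zetaDen(q,u) = zetaNum(q,u)
    -- where zetaDen(q,u) is invertible (so z = zetaNum · zetaDen⁻¹)
    record IsZetaValue (q u z : Carrier) : Set (c ⊔ ℓ) where
      field
        inv      : Carrier
        inv-left : inv * zetaDen q u ≈ 1#
        value    : z ≈ zetaNum q u * inv

-- Colour the two sides of the bipartition by ε = ±1, so that ε i ε j = -1 on every edge.
-- Conjugating I - qA + q²Q_u by diag ε fixes the diagonal matrices I and Q_u and negates A,
-- i.e. it replaces q by -q; as (det diag ε)² = 1, det(I - qA + q²Q_u) is even in q, and so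
-- is 1 - (1-u)²q².  Since the denominator is invertible, ζ_G is determined by numerator and
-- denominator, hence is even as well.
module Submission where

open import Defs hiding (sym)
open import Algebra.Bundles using (CommutativeRing)
open import Level using (Level)
open import Data.Nat using (zero; suc)
open import Data.Fin using (Fin; zero; suc; toℕ; punchIn)
open import Data.Fin.Properties using (_≟_)
open import Data.Bool using (Bool; true; false; if_then_else_)
open import Data.Integer using (+_; -[1+_])
open import Data.Product using (_,_)
open import Data.Vec using ([]; _∷_)
open import Relation.Nullary using (yes; no; contradiction)
open import Relation.Nullary.Decidable using (dec-false)
open import Relation.Binary.PropositionalEquality as ≡ using (_≡_; _≢_)
import Algebra.Properties.Ring as RingProperties
import Algebra.Properties.CommutativeSemigroup as CommutativeSemigroupProperties
import Algebra.Properties.Semiring.Sum as SemiringSum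
import Algebra.Properties.CommutativeMonoid.Sum as CommutativeMonoidSum
import Algebra.Solver.CommutativeMonoid as CommutativeMonoidSolver
import Relation.Binary.Reasoning.Setoid as SetoidReasoning

module _ {c ℓ} (R : CommutativeRing c ℓ) where
  open CommutativeRing R hiding (zero)
  open Zeta R
  open SetoidReasoning setoid
  open RingProperties ring
    using (-‿distribˡ-*; -‿distribʳ-*; -‿involutive; -0#≈0#; -1*x≈-x; x[y-z]≈xy-xz)
  open CommutativeSemigroupProperties *-commutativeSemigroup using (x∙yz≈y∙xz)
  open SemiringSum semiring using (sum; sum-cong-≋; *-distribˡ-sum)
  open CommutativeMonoidSum *-commutativeMonoid
    using () renaming (sum to ∏; sum-remove to ∏-remove; ∑-distrib-+ to ∏-distrib-*;
                       sum-cong-≋ to ∏-cong; sum-replicate-zero to ∏-replicate-1)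

  -x*-y≈x*y : ∀ x y → (- x) * (- y) ≈ x * y
  -x*-y≈x*y x y = begin
    (- x) * (- y) ≈⟨ -‿distribˡ-* x (- y) ⟨
    - (x * - y)   ≈⟨ -‿cong (-‿distribʳ-* x y) ⟨
    - - (x * y)   ≈⟨ -‿involutive (x * y) ⟩
    x * y         ∎

  pow-cong : ∀ {x y} k → x ≈ y → pow x k ≈ pow y k
  pow-cong zero    x≈y = refl
  pow-cong (suc k) x≈y = *-cong x≈y (pow-cong k x≈y)

  leftInverse-unique : ∀ {a b x} → a * x ≈ 1# → b * x ≈ 1# → a ≈ b
  leftInverse-unique {a} {b} {x} ax≈1 bx≈1 = begin
    a           ≈⟨ *-identityʳ a ⟨
    a * 1#      ≈⟨ *-congˡ bx≈1 ⟨
    a * (b * x) ≈⟨ x∙yz≈y∙xz a b x ⟩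
    b * (a * x) ≈⟨ *-congˡ ax≈1 ⟩
    b * 1#      ≈⟨ *-identityʳ b ⟩
    b           ∎

  Σ[]≡sum : ∀ {n} (f : Fin n → Carrier) → Σ[ f ] ≡ sum f
  Σ[]≡sum {zero}  f = ≡.refl
  Σ[]≡sum {suc n} f = ≡.cong (λ x → f zero + x) (Σ[]≡sum (λ i → f (suc i)))

  Σ-cong : ∀ {n} {f g : Fin n → Carrier} → (∀ i → f i ≈ g i) → Σ[ f ] ≈ Σ[ g ]
  Σ-cong {f = f} {g} f≈g = begin
    Σ[ f ] ≡⟨ Σ[]≡sum f ⟩
    sum f  ≈⟨ sum-cong-≋ f≈g ⟩
    sum g  ≡⟨ Σ[]≡sum g ⟨
    Σ[ g ] ∎

  *-distribˡ-Σ : ∀ {n} x (f : Fin n → Carrier) → x * Σ[ f ] ≈ Σ[ (λ i → x * f i) ]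
  *-distribˡ-Σ x f = begin
    x * Σ[ f ]               ≡⟨ ≡.cong (x *_) (Σ[]≡sum f) ⟩
    x * sum f                ≈⟨ *-distribˡ-sum x f ⟩
    sum (λ i → x * f i)      ≡⟨ Σ[]≡sum (λ i → x * f i) ⟨
    Σ[ (λ i → x * f i) ]     ∎

  ∏-square≈1 : ∀ {n} (s : Fin n → Carrier) → (∀ i → s i * s i ≈ 1#) → ∏ s * ∏ s ≈ 1#
  ∏-square≈1 {n} s s²≈1 = begin
    ∏ s * ∏ s              ≈⟨ ∏-distrib-* s s ⟨
    ∏ (λ i → s i * s i)    ≈⟨ ∏-cong s²≈1 ⟩
    ∏ {n} (λ _ → 1#)       ≈⟨ ∏-replicate-1 n ⟩
    1#                     ∎

  det-cong : ∀ {n} {N N′ : Matrix n} → (∀ i j → N i j ≈ N′ i j) → det N ≈ det N′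
  det-cong {zero}  N≈N′ = refl
  det-cong {suc n} N≈N′ = Σ-cong λ j →
    *-congˡ {sign (toℕ j)} (*-cong (N≈N′ zero j) (det-cong λ r k → N≈N′ (suc r) (punchIn j k)))

  det-scale : ∀ {n} (s t : Fin n → Carrier) (N : Matrix n) →
              det (λ i j → (s i * t j) * N i j) ≈ (∏ s * ∏ t) * det N
  det-scale {zero}  s t N = sym (trans (*-identityʳ _) (*-identityʳ 1#))
  det-scale {suc n} s t N = begin
    Σ[ (λ j → sign (toℕ j) * (((s zero * t j) * N zero j) * det (scaledMinor j))) ]
      ≈⟨ Σ-cong expand ⟩
    Σ[ (λ j → (∏ s * ∏ t) * cofactorTerm j) ]
      ≈⟨ *-distribˡ-Σ (∏ s * ∏ t) cofactorTerm ⟨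
    (∏ s * ∏ t) * det N ∎
    where
    scaledMinor : Fin (suc n) → Matrix n
    scaledMinor j r k = (s (suc r) * t (punchIn j k)) * minor N j r k

    cofactorTerm : Fin (suc n) → Carrier
    cofactorTerm j = sign (toℕ j) * (N zero j * det (minor N j))

    module S = CommutativeMonoidSolver *-commutativeMonoid

    regroup : ∀ σ a b x y z d →
              σ * (((a * b) * x) * ((y * z) * d)) ≈ ((a * y) * (b * z)) * (σ * (x * d))
    regroup σ a b x y z d =
      S.prove 7 (σ′ S.⊕ (((a′ S.⊕ b′) S.⊕ x′) S.⊕ ((y′ S.⊕ z′) S.⊕ d′)))
                (((a′ S.⊕ y′) S.⊕ (b′ S.⊕ z′)) S.⊕ (σ′ S.⊕ (x′ S.⊕ d′)))
                (σ ∷ a ∷ b ∷ x ∷ y ∷ z ∷ d ∷ [])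
      where
      σ′ = S.var zero
      a′ = S.var (suc zero)
      b′ = S.var (suc (suc zero))
      x′ = S.var (suc (suc (suc zero)))
      y′ = S.var (suc (suc (suc (suc zero))))
      z′ = S.var (suc (suc (suc (suc (suc zero)))))
      d′ = S.var (suc (suc (suc (suc (suc (suc zero))))))

    expand : ∀ j → sign (toℕ j) * (((s zero * t j) * N zero j) * det (scaledMinor j))
                   ≈ (∏ s * ∏ t) * cofactorTerm j
    expand j = begin
      sign (toℕ j) * (((s zero * t j) * N zero j) * det (scaledMinor j))
        ≈⟨ *-congˡ (*-congˡ (det-scale (λ r → s (suc r)) (λ k → t (punchIn j k)) (minor N j))) ⟩
      sign (toℕ j) * (((s zero * t j) * N zero j) *
                      ((∏ (λ r → s (suc r)) * ∏ (λ k → t (punchIn j k))) * det (minor N j)))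
        ≈⟨ regroup _ _ _ _ _ _ _ ⟩
      (∏ s * (t j * ∏ (λ k → t (punchIn j k)))) * cofactorTerm j
        ≈⟨ *-congʳ (*-congˡ (∏-remove t)) ⟨
      (∏ s * ∏ t) * cofactorTerm j ∎

  ±1 : Bool → Carrier
  ±1 b = if b then 1# else - 1#

  ±1-square : ∀ b → ±1 b * ±1 b ≈ 1#
  ±1-square true  = *-identityˡ 1#
  ±1-square false = trans (-x*-y≈x*y 1# 1#) (*-identityˡ 1#)

  ±1-distinct : ∀ {b b′} → b ≢ b′ → ±1 b * ±1 b′ ≈ - 1#
  ±1-distinct {true}  {true}  b≢b′ = contradiction ≡.refl b≢b′
  ±1-distinct {true}  {false} _    = *-identityˡ (- 1#)
  ±1-distinct {false} {true}  _    = *-identityʳ (- 1#)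
  ±1-distinct {false} {false} b≢b′ = contradiction ≡.refl b≢b′

  scaling-negates-variable : ∀ e q d a x → e * d ≈ d → e * a ≈ - a → e * x ≈ x →
                             e * (d - q * a + (q * q) * x) ≈ d - (- q) * a + ((- q) * (- q)) * x
  scaling-negates-variable e q d a x ed≈d ea≈-a ex≈x = begin
    e * (d - q * a + (q * q) * x)
      ≈⟨ distribˡ e (d - q * a) ((q * q) * x) ⟩
    e * (d - q * a) + e * ((q * q) * x)
      ≈⟨ +-congʳ (x[y-z]≈xy-xz e d (q * a)) ⟩
    e * d - e * (q * a) + e * ((q * q) * x)
      ≈⟨ +-cong (+-cong ed≈d (-‿cong (x∙yz≈y∙xz e q a))) (x∙yz≈y∙xz e (q * q) x) ⟩
    d - q * (e * a) + (q * q) * (e * x)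
      ≈⟨ +-cong (+-congˡ (-‿cong (*-congˡ ea≈-a))) (*-congˡ ex≈x) ⟩
    d - q * (- a) + (q * q) * x
      ≈⟨ +-cong (+-congˡ (-‿cong (trans (sym (-‿distribˡ-* q a)) (-‿distribʳ-* q a))))
                (*-congʳ (-x*-y≈x*y q q)) ⟨
    d - (- q) * a + ((- q) * (- q)) * x ∎

  module _ (G : SimpleGraph) where

    δ-offDiagonal : ∀ {i j} → i ≢ j → δ G i j ≈ 0#
    δ-offDiagonal {i} {j} i≢j =
      reflexive (≡.cong (λ b → if b then 1# else 0#) (dec-false (i ≟ j) i≢j))

    Q-offDiagonal : ∀ u {i j} → i ≢ j → Q G u i j ≈ 0#
    Q-offDiagonal u {i} {j} i≢j = begin
      (1# - u) * (δ G i j * deg G i - (1# - u) * δ G i j)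
        ≈⟨ *-congˡ (+-cong (*-congʳ δ≈0) (-‿cong (*-congˡ δ≈0))) ⟩
      (1# - u) * (0# * deg G i - (1# - u) * 0#)
        ≈⟨ *-congˡ (+-cong (zeroˡ (deg G i)) (-‿cong (zeroʳ (1# - u)))) ⟩
      (1# - u) * (0# - 0#)
        ≈⟨ *-congˡ (-‿inverseʳ 0#) ⟩
      (1# - u) * 0#
        ≈⟨ zeroʳ (1# - u) ⟩
      0# ∎
      where
      δ≈0 : δ G i j ≈ 0#
      δ≈0 = δ-offDiagonal i≢j

    F-even : ∀ q u → F G (- q) u ≈ F G q u
    F-even q u = +-congˡ (-‿cong (*-congˡ (-x*-y≈x*y q q)))

    zetaNum-even : ∀ q u → zetaNum G (- q) u ≈ zetaNum G q u
    zetaNum-even q u with edgeExcess G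
    ... | + k      = refl
    ... | -[1+ k ] = pow-cong (suc k) (F-even q u)

    zetaDen-even : ∀ q u → det (M G (- q) u) ≈ det (M G q u) →
                   zetaDen G (- q) u ≈ zetaDen G q u
    zetaDen-even q u det-even with edgeExcess G
    ... | + k      = *-cong (pow-cong k (F-even q u)) det-even
    ... | -[1+ k ] = det-even

    zetaValue-unique : ∀ {q q′ u z z′} →
                       zetaNum G q u ≈ zetaNum G q′ u → zetaDen G q u ≈ zetaDen G q′ u →
                       IsZetaValue G q u z → IsZetaValue G q′ u z′ → z ≈ z′
    zetaValue-unique {q} {q′} {u} {z} {z′} num≈ den≈ ζ ζ′ = begin
      z                       ≈⟨ value ζ ⟩
      zetaNum G q u * inv ζ   ≈⟨ *-cong num≈ inv≈inv′ ⟩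
      zetaNum G q′ u * inv ζ′ ≈⟨ value ζ′ ⟨
      z′                      ∎
      where
      open IsZetaValue
      inv≈inv′ : inv ζ ≈ inv ζ′
      inv≈inv′ = leftInverse-unique (inv-left ζ) (trans (*-congˡ den≈) (inv-left ζ′))

    module _ (colour : Fin (nV G) → Bool)
             (proper : ∀ i j → adj G i j ≡ true → colour i ≢ colour j) where

      ε : Fin (nV G) → Carrier
      ε i = ±1 (colour i)

      ε-square : ∀ i → ε i * ε i ≈ 1#
      ε-square i = ±1-square (colour i)

      ε-fixes-diagonal : ∀ {i j} x → (i ≢ j → x ≈ 0#) → (ε i * ε j) * x ≈ x
      ε-fixes-diagonal {i} {j} x offDiagonal with i ≟ j
      ... | yes ≡.refl = trans (*-congʳ (ε-square i)) (*-identityˡ x)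
      ... | no i≢j     =
        trans (*-congˡ (offDiagonal i≢j)) (trans (zeroʳ (ε i * ε j)) (sym (offDiagonal i≢j)))

      ε-negates-A : ∀ i j → (ε i * ε j) * A G i j ≈ - A G i j
      ε-negates-A i j with adj G i j in edge
      ... | true  = trans (*-congʳ (±1-distinct (proper i j edge))) (-1*x≈-x 1#)
      ... | false = trans (zeroʳ _) (sym -0#≈0#)

      M-negated : ∀ q u i j → M G (- q) u i j ≈ (ε i * ε j) * M G q u i j
      M-negated q u i j = sym (scaling-negates-variable (ε i * ε j) q _ _ _
        (ε-fixes-diagonal _ δ-offDiagonal) (ε-negates-A i j) (ε-fixes-diagonal _ (Q-offDiagonal u)))

      det-M-even : ∀ q u → det (M G (- q) u) ≈ det (M G q u)
      det-M-even q u = begin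
        det (M G (- q) u)                       ≈⟨ det-cong (M-negated q u) ⟩
        det (λ i j → (ε i * ε j) * M G q u i j) ≈⟨ det-scale ε ε (M G q u) ⟩
        (∏ ε * ∏ ε) * det (M G q u)             ≈⟨ *-congʳ (∏-square≈1 ε ε-square) ⟩
        1# * det (M G q u)                      ≈⟨ *-identityˡ (det (M G q u)) ⟩
        det (M G q u)                           ∎

lemma4p13 : ∀ {c ℓ : Level} (R : CommutativeRing c ℓ) (G : SimpleGraph) →
    Connected G → Bipartite G →
    ∀ (q u z z′ : CommutativeRing.Carrier R) →
    Zeta.IsZetaValue R G q u z →
    Zeta.IsZetaValue R G (CommutativeRing.-_ R q) u z′ →
    CommutativeRing._≈_ R z z′
lemma4p13 R G _ (colour , proper) q u z z′ ζ ζ′ =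
  zetaValue-unique R G
    (sym (zetaNum-even R G q u))
    (sym (zetaDen-even R G q u (det-M-even R G colour proper q u)))
    ζ ζ′
  where open CommutativeRing R using (sym)
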